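{- Let $G$ be a CGS with $G\models\varphi^{ord}$, and let $R^<$ be the relation on strategies of $G$ given by $R^<(f_1,f_2)$ iff $G,\emptyset[x_1\mapsto f_1][x_2\mapsto f_2],s_0\models x_1<x_2$. Then $R^<$ is a strict partial order without maximal element.
   Context: A concurrent game structure (CGS) $G=(\mathrm{AP},\mathrm{Ag},\mathrm{Ac},\mathrm{St},\lambda,\tau,s_0)$ has finite non-empty sets of atomic propositions and agents, countable non-empty sets of actions and states, initial state $s_0$, labeling $\lambda$ and transition function $\tau:\mathrm{St}\times\mathrm{Ac}^{\mathrm{Ag}}\to\mathrm{St}$. Strategies are maps from tracks (finite histories of states) to actions; assignments map variables/agents to strategies, $\emptyset$ is the empty assignment and $\chi[x\mapsto f]$ updates $\chi$. SL semantics: $\langle\langle y\rangle\rangle$/$[\![x]\!]$ quantify existentially/universally over strategies assigned to the variable; $(a,x)$ makes agent $a$ use the strategy of $x$; temporal operators are evaluated as in LTL on the unique play from the current state once all agents are bound; $G\models\varphi$ iff $\varphi$ holds at $s_0$ under $\emptyset$. Over $\mathrm{AP}=\{p\}$, $\mathrm{Ag}=\{\alpha,\beta\}$: $x_1<x_2$ abbreviates $\langle\langle y\rangle\rangle\big(((\alpha,x_1)(\beta,y)(\mathsf{X}p))\wedge((\alpha,x_2)(\beta,y)(\mathsf{X}\neg p))\big)$; $\varphi^{ord}=\varphi^{unb}\wedge\varphi^{trn}$ with $\varphi^{unb}=[\![x_1]\!]\langle\langle x_2\rangle\rangle\,x_1<x_2$ and $\varphi^{trn}=[\![x_1]\!][\![x_2]\!][\![x_3]\!]\,(x_1<x_2\wedge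 x_2<x_3)\rightarrow x_1<x_3$. -}

module Defs where

open import Data.Nat using (ℕ; zero; suc; _<_)
open import Data.Bool using (Bool; true; false; if_then_else_)
open import Data.Maybe using (Maybe; just; nothing)
open import Data.Product using (Σ; _×_; _,_; ∃-syntax)
open import Data.Sum using (_⊎_)
open import Data.Empty using (⊥)
open import Relation.Nullary using (¬_)
open import Relation.Binary.PropositionalEquality using (_≡_)
open import Function.Definitions using (Injective)

data AP : Set where
  p : AP

data Agent : Set where
  α β : Agent

-- Concurrent game structures over AP and Ag.
-- Ac and St are countable (injection into ℕ) and non-empty.

record CGS : Set₁ where
  field
    Ac      : Set
    St      : Set
    encAc   : Ac → ℕ
    encAc-injective : Injective _≡_ _≡_ encAc
    encSt   : St → ℕ
    encSt-injective : Injective _≡_ _≡_ encSt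
    someAc  : Ac
    label   : St → AP → Bool
    τ       : St → (Agent → Ac) → St
    s₀      : St

Var : Set
Var = ℕ

infixr 5 _∧'_ _∨'_
infixr 4 _⇒'_
data Formula : Set where
  atom   : AP → Formula
  ¬'_    : Formula → Formula
  _∧'_   : Formula → Formula → Formula
  _∨'_   : Formula → Formula → Formula
  _⇒'_   : Formula → Formula → Formula
  X'_    : Formula → Formula
  _U'_   : Formula → Formula → Formula
  ⟪_⟫_   : Var → Formula → Formula
  ⟦_⟧_   : Var → Formula → Formula
  bind   : Agent → Var → Formula → Formula

agentEq : Agent → Agent → Bool
agentEq α α = true
agentEq β β = true
agentEq _ _ = false

module _ (G : CGS) where
  open CGS G

  data Track : Set where
    start : St → Track
    _▹_   : Track → St → Track

  last : Track → St
  last (start s) = s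
  last (h ▹ s)   = s

  Strategy : Set
  Strategy = Track → Ac

  record Assignment : Set where
    field
      varA : Var → Maybe Strategy
      agA  : Agent → Maybe Strategy
  open Assignment

  ∅ : Assignment
  ∅ = record { varA = λ _ → nothing ; agA = λ _ → nothing }

  _[_↦_] : Assignment → Var → Strategy → Assignment
  χ [ x ↦ f ] = record χ { varA = upd }
    where
      upd : Var → Maybe Strategy
      upd z with Data.Nat._≟_ z x
      ... | Relation.Nullary.yes _ = just f
      ... | Relation.Nullary.no _  = varA χ z

  _[ag_↦_] : Assignment → Agent → Strategy → Assignment
  χ [ag a ↦ f ] = record χ { agA = upd }
    where
      upd : Agent → Maybe Strategy
      upd b = if agentEq b a then just f else agA χ b

  profile : Assignment → Maybe (Agent → Strategy)
  profile χ with agA χ α | agA χ β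
  ... | just f | just g = just (λ { α → f ; β → g })
  ... | _      | _      = nothing

  step : (Agent → Strategy) → Track → Track
  step P h = h ▹ τ (last h) (λ a → P a h)

  steps : (Agent → Strategy) → ℕ → Track → Track
  steps P zero h    = h
  steps P (suc k) h = steps P k (step P h)

  -- Satisfaction G, χ, h ⊨ φ (the current state is last h; the play
  -- continues the history h, strategies are applied to whole histories)
  Sat : Formula → Assignment → Track → Set
  Sat (atom q) χ h = label (last h) q ≡ true
  Sat (¬' φ) χ h = ¬ Sat φ χ h
  Sat (φ ∧' ψ) χ h = Sat φ χ h × Sat ψ χ h
  Sat (φ ∨' ψ) χ h = Sat φ χ h ⊎ Sat ψ χ h
  Sat (φ ⇒' ψ) χ h = Sat φ χ h → Sat ψ χ h
  Sat (X' φ) χ h with profile χ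
  ... | nothing = ⊥
  ... | just P  = Sat φ χ (step P h)
  Sat (φ U' ψ) χ h with profile χ
  ... | nothing = ⊥
  ... | just P  = ∃[ k ] (Sat ψ χ (steps P k h) × (∀ j → j < k → Sat φ χ (steps P j h)))
  Sat (⟪ x ⟫ φ) χ h = ∃[ f ] Sat φ (χ [ x ↦ f ]) h
  Sat (⟦ x ⟧ φ) χ h = ∀ f → Sat φ (χ [ x ↦ f ]) h
  Sat (bind a x φ) χ h with varA χ x
  ... | nothing = ⊥
  ... | just f  = Sat φ (χ [ag a ↦ f ]) h

  Models : Formula → Set
  Models φ = Sat φ ∅ (start s₀)

x₁ x₂ x₃ y : Var
x₁ = 1
x₂ = 2
x₃ = 3
y  = 0

_≺_ : Var → Var → Formula
x ≺ x' = ⟪ y ⟫ (bind α x (bind β y (X' atom p)) ∧' bind α x' (bind β y (X' (¬' atom p))))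

φunb : Formula
φunb = ⟦ x₁ ⟧ ⟪ x₂ ⟫ (x₁ ≺ x₂)

φtrn : Formula
φtrn = ⟦ x₁ ⟧ ⟦ x₂ ⟧ ⟦ x₃ ⟧ (((x₁ ≺ x₂) ∧' (x₂ ≺ x₃)) ⇒' (x₁ ≺ x₃))

φord : Formula
φord = φunb ∧' φtrn

R< : (G : CGS) → Strategy G → Strategy G → Set
R< G f₁ f₂ = Sat G (x₁ ≺ x₂) (_[_↦_] G (_[_↦_] G (∅ G) x₁ f₁) x₂ f₂) (start (CGS.s₀ G))

NoMaximalElement : {A : Set} → (A → A → Set) → Set
NoMaximalElement {A} R = ∀ (a : A) → ∃[ b ] R a b

module Submission where

open import Defs
open import Data.Product using (_×_; _,_)
open import Relation.Binary.Definitions using (Irreflexive; Transitive)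
open import Relation.Binary.PropositionalEquality using (_≡_; refl; isEquivalence; resp₂)
open import Relation.Binary.Structures using (IsStrictPartialOrder)

-- A common counter-strategy of β would make p both hold and fail at the next state.
R<-irreflexive : (G : CGS) → Irreflexive _≡_ (R< G)
R<-irreflexive G refl (_ , next-p , next-¬p) = next-¬p next-p

-- φtrn instantiated at f₁ f₂ f₃ is literally transitivity: the extra binding of
-- x₃ is invisible, since variable lookup reduces on the numerals x₁, x₂, y.
R<-transitive : (G : CGS) → Models G φtrn → Transitive (R< G)
R<-transitive G trn {f₁} {f₂} {f₃} r₁₂ r₂₃ = trn f₁ f₂ f₃ (r₁₂ , r₂₃)

R<-isStrictPartialOrder : (G : CGS) → Models G φtrn → IsStrictPartialOrder _≡_ (R< G)
R<-isStrictPartialOrder G trn = record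
  { isEquivalence = isEquivalence
  ; irrefl        = R<-irreflexive G
  ; trans         = R<-transitive G trn
  ; <-resp-≈      = resp₂ (R< G)
  }

R<-noMaximalElement : (G : CGS) → Models G φunb → NoMaximalElement (R< G)
R<-noMaximalElement G unb = unb

lemma3p3 : (G : CGS) → Models G φord → IsStrictPartialOrder _≡_ (R< G) × NoMaximalElement (R< G)
lemma3p3 G (unb , trn) = R<-isStrictPartialOrder G trn , R<-noMaximalElement G unb
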